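{- For every integer $h\ge1$, let $t_{n,m,h}$ be the number of active growing binary trees of height $h$ with $n$ internal nodes and $m$ anchors, let $S_h=\{(n,k)\in\mathbb{Z}_{>0}^2 : t_{n,2k,h}\neq0\}$ and $\Lambda_h=\{(n,k)\in S_h : t_{n,2(k+1),h}=0\}$. For integers $i,j$ and $S\subseteq\mathbb{Z}^2$ let $\sigma_{i,j}(S)=\{(n+i,k+j):(n,k)\in S\}$. Then for every positive integer $h$, \[ \Lambda_{h+1}=\sigma_{1,0}(\Lambda_h)\ \cup\ L_h\ \cup\ \sigma_{2^h,2^{h-1}}(\Lambda_h),\qquad L_h=\{(2^h+i,\,2^{h-1}) : 1\le i\le h-1\}, \] and $|\Lambda_h|=2^h-h$.
   Context: Growing binary trees are plane (ordered) binary trees whose nodes are of three types: internal nodes, anchors (active leaves) and dead leaves. They are produced by the following growth process: at time $t=0$ the tree consists of a single anchor; at each time $t=1,2,\dots$, every anchor is simultaneously replaced either by a dead leaf or by an internal node with two anchors as children. A growing binary tree is any tree obtainable after finitely many steps of this process; it is active if it has at least one anchor. The height of a tree is the maximal distance from the root to a node. -}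

module Defs where

open import Data.Nat using (ℕ; zero; suc; _+_; _*_; _∸_; _^_; _≤_; _<_; _⊔_)
open import Data.Product using (Σ; ∃; ∃-syntax; _×_; _,_)
open import Data.Sum using (_⊎_)
open import Data.List using (List; length)
open import Data.List.Membership.Propositional using (_∈_)
open import Data.List.Relation.Unary.Unique.Propositional using (Unique)
open import Relation.Nullary using (¬_)
open import Relation.Binary.PropositionalEquality using (_≡_)
open import Function.Bundles using (_⇔_)

data Tree : Set where
  anchor : Tree
  dead   : Tree
  node   : Tree → Tree → Tree

data Step : Tree → Tree → Set where
  anchor-dead : Step anchor dead
  anchor-node : Step anchor (node anchor anchor)
  dead-dead   : Step dead dead
  node-node   : ∀ {l r l′ r′} → Step l l′ → Step r r′ → Step (node l r) (node l′ r′)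

data ReachedAt : ℕ → Tree → Set where
  start : ReachedAt zero anchor
  grow  : ∀ {t T T′} → ReachedAt t T → Step T T′ → ReachedAt (suc t) T′

Growing : Tree → Set
Growing T = ∃[ t ] ReachedAt t T

internals : Tree → ℕ
internals anchor     = 0
internals dead       = 0
internals (node l r) = suc (internals l + internals r)

anchors : Tree → ℕ
anchors anchor     = 1
anchors dead       = 0
anchors (node l r) = anchors l + anchors r

height : Tree → ℕ
height anchor     = 0
height dead       = 0
height (node l r) = suc (height l ⊔ height r)

Active : Tree → Set
Active T = Growing T × 1 ≤ anchors T

TNonzero : ℕ → ℕ → ℕ → Set
TNonzero n m h = ∃[ T ] (Active T × height T ≡ h × internals T ≡ n × anchors T ≡ m)

S : ℕ → ℕ → ℕ → Set
S h n k = 0 < n × 0 < k × TNonzero n (2 * k) h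

Λ : ℕ → ℕ → ℕ → Set
Λ h n k = S h n k × ¬ TNonzero n (2 * (k + 1)) h

σ : ℕ → ℕ → (ℕ → ℕ → Set) → ℕ → ℕ → Set
σ i j P n k = ∃[ n′ ] ∃[ k′ ] (P n′ k′ × n ≡ n′ + i × k ≡ k′ + j)

L : ℕ → ℕ → ℕ → Set
L h n k = ∃[ i ] (1 ≤ i × i ≤ h ∸ 1 × n ≡ 2 ^ h + i × k ≡ 2 ^ (h ∸ 1))

HasCard : (ℕ → ℕ → Set) → ℕ → Set
HasCard P c = Σ (List (ℕ × ℕ)) λ xs →
  Unique xs × (∀ n k → ((n , k) ∈ xs) ⇔ P n k) × length xs ≡ c

-- Anchors always sit on the deepest level, so an active tree of height h is one reached at time h,
-- and only the pair (internal nodes n, anchors m) matters: a step turns x ≤ m anchors into internal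
-- nodes, giving (n + x, 2x). By induction on h, (n, 2k) occurs at time h + 1 iff 1 ≤ k ≤ 2^h and
-- μ_h(k) ≤ n < 2^h + k, where μ_h(k) = Σ_{i ≤ h} ⌈k / 2^i⌉. Hence column k of Λ_{h+1} is the
-- interval μ_h(k) ≤ n < min(μ_h(k + 1), 2^h + k). For 1 ≤ k ≤ 2^h we have μ_{h+1}(k) = μ_h(k) + 1
-- and μ_{h+1}(k + 2^h) = μ_h(k) + 2^{h+1}, so Λ_{h+2} consists of the columns k < 2^h of Λ_{h+1}
-- shifted by (1, 0), all its columns shifted by (2^{h+1}, 2^h), and column 2^h, which is
-- 2^{h+1} ≤ n ≤ 2^{h+1} + h: one shifted point of Λ_{h+1} followed by the row L_{h+1}. These parts
-- are disjoint, so |Λ_{h+2}| = 2 |Λ_{h+1}| + h.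

module Submission where

open import Defs
open import Data.List using ([]; _∷_; map; _++_; applyUpTo)
open import Data.List.Membership.Propositional using (_∈_)
open import Data.List.Membership.Propositional.Properties
  using (∈-map⁺; ∈-map⁻; ++-∈⇔; ∈-applyUpTo⁺; ∈-applyUpTo⁻)
open import Data.List.Properties using (length-map; length-++; length-applyUpTo)
open import Data.List.Relation.Unary.All using ([])
open import Data.List.Relation.Unary.AllPairs using ([]; _∷_)
open import Data.List.Relation.Unary.Any using (here)
import Data.List.Relation.Unary.Unique.Propositional.Properties as Unique
open import Data.Nat
open import Data.Nat.Properties
open import Algebra.Properties.CommutativeSemigroup +-commutativeSemigroup using (interchange)
open import Data.Nat.Tactic.RingSolver using (solve-∀)
open import Data.Product using (_×_; _,_; ∃-syntax; proj₁; proj₂)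
open import Data.Sum using (_⊎_; inj₁; inj₂; [_,_]′)
open import Data.Sum.Function.Propositional using (_⊎-⇔_)
open import Function.Base using (_∘_)
open import Function.Bundles using (_⇔_; mk⇔; Equivalence)
open import Function.Construct.Composition using (_⇔-∘_)
open import Function.Construct.Identity using (⇔-id)
open import Function.Construct.Symmetry using (⇔-sym)
open import Relation.Binary.Definitions using (tri<; tri≈; tri>)
open import Relation.Binary.PropositionalEquality
open import Relation.Nullary using (¬_; yes; no)

2*n≡n+n : ∀ n → 2 * n ≡ n + n
2*n≡n+n n = cong (n +_) (+-identityʳ n)

1≤2^n : ∀ n → 1 ≤ 2 ^ n
1≤2^n = m^n>0 2

2^n<2^[1+n] : ∀ n → 2 ^ n < 2 ^ suc n
2^n<2^[1+n] n = ^-monoʳ-< 2 (s≤s (s≤s z≤n)) (n<1+n n)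

1+n≤2^n : ∀ n → suc n ≤ 2 ^ n
1+n≤2^n zero    = ≤-refl
1+n≤2^n (suc n) = subst (2 + n ≤_) (sym (2*n≡n+n (2 ^ n))) (+-mono-≤ (1≤2^n n) (1+n≤2^n n))

shift-interval : ∀ {a b c n} → a + c ≤ n → n < b + c → ∃[ m ] (a ≤ m × m < b × n ≡ m + c)
shift-interval {a} {b} {c} {n} a+c≤n n<b+c =
  n ∸ c ,
  m+n≤o⇒m≤o∸n a a+c≤n ,
  +-cancelʳ-< c (n ∸ c) b (subst (_< b + c) (sym n∸c+c≡n) n<b+c) ,
  sym n∸c+c≡n
  where
  n∸c+c≡n : n ∸ c + c ≡ n
  n∸c+c≡n = m∸n+n≡m (≤-trans (m≤n+m c a) a+c≤n)

⌈n/2⌉≤m⇒n≤2*m : ∀ n {m} → ⌈ n /2⌉ ≤ m → n ≤ 2 * m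
⌈n/2⌉≤m⇒n≤2*m n {m} p = begin
  n                    ≡⟨ ⌊n/2⌋+⌈n/2⌉≡n n ⟨
  ⌊ n /2⌋ + ⌈ n /2⌉    ≤⟨ +-monoˡ-≤ ⌈ n /2⌉ (⌊n/2⌋≤⌈n/2⌉ n) ⟩
  ⌈ n /2⌉ + ⌈ n /2⌉    ≤⟨ +-mono-≤ p p ⟩
  m + m                ≡⟨ 2*n≡n+n m ⟨
  2 * m                ∎
  where open ≤-Reasoning

n≤2*m⇒⌈n/2⌉≤m : ∀ {n m} → n ≤ 2 * m → ⌈ n /2⌉ ≤ m
n≤2*m⇒⌈n/2⌉≤m {n} {m} p =
  ≤-trans (⌈n/2⌉-mono (subst (n ≤_) (2*n≡n+n m) p)) (≤-reflexive (sym (n≡⌈n+n/2⌉ m)))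

⌈2*m+n/2⌉≡m+⌈n/2⌉ : ∀ m n → ⌈ 2 * m + n /2⌉ ≡ m + ⌈ n /2⌉
⌈2*m+n/2⌉≡m+⌈n/2⌉ zero    n = refl
⌈2*m+n/2⌉≡m+⌈n/2⌉ (suc m) n rewrite +-suc m (m + 0) = cong suc (⌈2*m+n/2⌉≡m+⌈n/2⌉ m n)

-- The growth process keeps every anchor on the deepest level.
data Layered : ℕ → Tree → Set where
  anchor : Layered 0 anchor
  dead   : ∀ {t} → Layered t dead
  node   : ∀ {t l r} → Layered t l → Layered t r → Layered (suc t) (node l r)

Layered-step : ∀ {t T T′} → Layered t T → Step T T′ → Layered (suc t) T′
Layered-step anchor anchor-dead         = dead
Layered-step anchor anchor-node         = node anchor anchor
Layered-step dead   dead-dead           = dead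
Layered-step (node l r) (node-node s u) = node (Layered-step l s) (Layered-step r u)

reached⇒Layered : ∀ {t T} → ReachedAt t T → Layered t T
reached⇒Layered start      = anchor
reached⇒Layered (grow r s) = Layered-step (reached⇒Layered r) s

Layered⇒height≤ : ∀ {t T} → Layered t T → height T ≤ t
Layered⇒height≤ anchor     = z≤n
Layered⇒height≤ dead       = z≤n
Layered⇒height≤ (node l r) = s≤s (⊔-lub (Layered⇒height≤ l) (Layered⇒height≤ r))

Layered⇒height≥ : ∀ {t T} → Layered t T → 1 ≤ anchors T → t ≤ height T
Layered⇒height≥ anchor _ = z≤n
Layered⇒height≥ (node {l = l} {r} layˡ layʳ) p with 1 ≤? anchors l
... | yes q = s≤s (≤-trans (Layered⇒height≥ layˡ q) (m≤m⊔n (height l) (height r)))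
... | no q  = s≤s (≤-trans (Layered⇒height≥ layʳ q′) (m≤n⊔m (height l) (height r)))
  where
  q′ : 1 ≤ anchors r
  q′ = subst (λ a → 1 ≤ a + anchors r) (n<1⇒n≡0 (≰⇒> q)) p

reached⇒height≡ : ∀ {t T} → ReachedAt t T → 1 ≤ anchors T → height T ≡ t
reached⇒height≡ r p = ≤-antisym (Layered⇒height≤ layered) (Layered⇒height≥ layered p)
  where
  layered = reached⇒Layered r

data Counts : ℕ → ℕ → ℕ → Set where
  start : Counts 0 0 1
  grow  : ∀ {t n m} x → x ≤ m → Counts t n m → Counts (suc t) (n + x) (2 * x)

record StepBy (x : ℕ) (T T′ : Tree) : Set where
  constructor stepBy
  field
    internals≡ : internals T′ ≡ internals T + x
    anchors≡   : anchors T′ ≡ 2 * x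

StepBy-node : ∀ {x y l r l′ r′} → StepBy x l l′ → StepBy y r r′ → StepBy (x + y) (node l r) (node l′ r′)
StepBy-node {x} {y} {l} {r} (stepBy il al) (stepBy ir ar) = stepBy
  (cong suc (trans (cong₂ _+_ il ir) (interchange (internals l) x (internals r) y)))
  (trans (cong₂ _+_ al ar) (sym (*-distribˡ-+ 2 x y)))

step-counts : ∀ {T T′} → Step T T′ → ∃[ x ] (x ≤ anchors T × StepBy x T T′)
step-counts anchor-dead     = 0 , z≤n , stepBy refl refl
step-counts anchor-node     = 1 , s≤s z≤n , stepBy refl refl
step-counts dead-dead       = 0 , z≤n , stepBy refl refl
step-counts (node-node s u) with step-counts s | step-counts u
... | x , x≤ , e | y , y≤ , f = x + y , +-mono-≤ x≤ y≤ , StepBy-node e f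

step-realises : ∀ T {x} → x ≤ anchors T → ∃[ T′ ] (Step T T′ × StepBy x T T′)
step-realises anchor {0} _       = dead , anchor-dead , stepBy refl refl
step-realises anchor {1} _       = node anchor anchor , anchor-node , stepBy refl refl
step-realises anchor {2+ _} (s≤s ())
step-realises dead   z≤n         = dead , dead-dead , stepBy refl refl
step-realises (node l r) {x} x≤
  with step-realises l (m⊓n≤m (anchors l) x) | step-realises r (m≤n+o⇒m∸n≤o x (anchors l) x≤)
... | l′ , s , e | r′ , u , f =
  node l′ r′ , node-node s u ,
  subst (λ y → StepBy y (node l r) (node l′ r′)) (m⊓n+n∸m≡n (anchors l) x) (StepBy-node e f)

reached⇒Counts : ∀ {t T} → ReachedAt t T → Counts t (internals T) (anchors T)
reached⇒Counts start = start
reached⇒Counts (grow r s) with step-counts s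
... | x , x≤ , stepBy ie ae rewrite ie | ae = grow x x≤ (reached⇒Counts r)

Counts⇒reached : ∀ {t n m} → Counts t n m → ∃[ T ] (ReachedAt t T × internals T ≡ n × anchors T ≡ m)
Counts⇒reached start = anchor , start , refl , refl
Counts⇒reached (grow x x≤ c) with Counts⇒reached c
... | T , r , refl , refl with step-realises T x≤
... | T′ , s , stepBy ie ae = T′ , grow r s , ie , ae

TNonzero⇔Counts : ∀ {n m h} → TNonzero n m h ⇔ (1 ≤ m × Counts h n m)
TNonzero⇔Counts {n} {m} {h} = mk⇔ to from
  where
  to : TNonzero n m h → 1 ≤ m × Counts h n m
  to (T , ((t , r) , active) , refl , refl , refl) rewrite reached⇒height≡ r active =
    active , reached⇒Counts r
  from : 1 ≤ m × Counts h n m → TNonzero n m h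
  from (1≤m , c) with Counts⇒reached c
  ... | T , r , refl , refl = T , ((h , r) , 1≤m) , reached⇒height≡ r 1≤m , refl , refl

-- minInternals h k = Σ_{i ≤ h} ⌈k / 2^i⌉: 2k anchors at depth h + 1 need ⌈k / 2^i⌉ internal nodes
-- at depth h − i.
minInternals : ℕ → ℕ → ℕ
minInternals zero    k = k
minInternals (suc h) k = k + minInternals h ⌈ k /2⌉

minInternals-mono : ∀ h {k k′} → k ≤ k′ → minInternals h k ≤ minInternals h k′
minInternals-mono zero    p = p
minInternals-mono (suc h) p = +-mono-≤ p (minInternals-mono h (⌈n/2⌉-mono p))

k≤minInternals : ∀ h k → k ≤ minInternals h k
k≤minInternals zero    k = ≤-refl
k≤minInternals (suc h) k = m≤m+n k _

minInternals-<-[1+k] : ∀ h k → minInternals h k < minInternals h (suc k)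
minInternals-<-[1+k] zero    k = n<1+n k
minInternals-<-[1+k] (suc h) k = +-mono-<-≤ (n<1+n k) (minInternals-mono h (⌈n/2⌉-mono (n≤1+n k)))

minInternals<2^h+k : ∀ h {k} → 1 ≤ k → k ≤ 2 ^ h → minInternals h k < 2 ^ h + k
minInternals<2^h+k zero {1} _ _ = n<1+n 1
minInternals<2^h+k zero {2+ _} _ (s≤s ())
minInternals<2^h+k (suc h) {k} 1≤k k≤ = begin-strict
  k + minInternals h ⌈ k /2⌉   <⟨ +-monoʳ-< k (minInternals<2^h+k h (⌈n/2⌉-mono 1≤k) c≤) ⟩
  k + (2 ^ h + ⌈ k /2⌉)        ≤⟨ +-monoʳ-≤ k (+-monoʳ-≤ (2 ^ h) c≤) ⟩
  k + (2 ^ h + 2 ^ h)          ≡⟨ cong (k +_) (2*n≡n+n (2 ^ h)) ⟨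
  k + 2 ^ suc h                ≡⟨ +-comm k _ ⟩
  2 ^ suc h + k                ∎
  where
  open ≤-Reasoning
  c≤ : ⌈ k /2⌉ ≤ 2 ^ h
  c≤ = n≤2*m⇒⌈n/2⌉≤m k≤

minInternals-[1+h] : ∀ h {k} → 1 ≤ k → k ≤ 2 ^ h → minInternals (suc h) k ≡ suc (minInternals h k)
minInternals-[1+h] zero    {1} _ _ = refl
minInternals-[1+h] zero    {2+ _} _ (s≤s ())
minInternals-[1+h] (suc h) {k} 1≤k k≤ =
  trans (cong (k +_) (minInternals-[1+h] h (⌈n/2⌉-mono 1≤k) (n≤2*m⇒⌈n/2⌉≤m k≤))) (+-suc k _)

minInternals-[1+h]-+2^h : ∀ h {k} → 1 ≤ k → k ≤ 2 ^ h →
                          minInternals (suc h) (k + 2 ^ h) ≡ minInternals h k + 2 ^ suc h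
minInternals-[1+h]-+2^h zero    {1} _ _ = refl
minInternals-[1+h]-+2^h zero    {2+ _} _ (s≤s ())
minInternals-[1+h]-+2^h (suc h) {k} 1≤k k≤ = begin
  (k + Q) + minInternals (suc h) ⌈ k + 2 * P /2⌉   ≡⟨ cong (λ d → (k + Q) + minInternals (suc h) d) half ⟩
  (k + Q) + minInternals (suc h) (c + P)           ≡⟨ cong ((k + Q) +_) (minInternals-[1+h]-+2^h h 1≤c c≤P) ⟩
  (k + Q) + (M + Q)                                ≡⟨ interchange k Q M Q ⟩
  (k + M) + (Q + Q)                                ≡⟨ cong ((k + M) +_) (2*n≡n+n Q) ⟨
  (k + M) + 2 * Q                                  ∎
  where
  open ≡-Reasoning
  P Q c M : ℕ
  P = 2 ^ h
  Q = 2 ^ suc h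
  c = ⌈ k /2⌉
  M = minInternals h c
  1≤c : 1 ≤ c
  1≤c = ⌈n/2⌉-mono 1≤k
  c≤P : c ≤ P
  c≤P = n≤2*m⇒⌈n/2⌉≤m k≤
  half : ⌈ k + 2 * P /2⌉ ≡ c + P
  half = trans (cong ⌈_/2⌉ (+-comm k (2 * P))) (trans (⌈2*m+n/2⌉≡m+⌈n/2⌉ P k) (+-comm P c))

1+minInternals-2^h : ∀ h → suc (minInternals h (2 ^ h)) ≡ 2 ^ suc h
1+minInternals-2^h zero    = refl
1+minInternals-2^h (suc h) = begin
  suc (minInternals (suc h) (2 * P))   ≡⟨ cong (suc ∘ minInternals (suc h)) (2*n≡n+n P) ⟩
  suc (minInternals (suc h) (P + P))   ≡⟨ cong suc (minInternals-[1+h]-+2^h h (1≤2^n h) ≤-refl) ⟩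
  suc (minInternals h P) + Q           ≡⟨ cong (_+ Q) (1+minInternals-2^h h) ⟩
  Q + Q                                ≡⟨ 2*n≡n+n Q ⟨
  2 * Q                                ∎
  where
  open ≡-Reasoning
  P Q : ℕ
  P = 2 ^ h
  Q = 2 ^ suc h

minInternals-[1+h]-2^h : ∀ h → minInternals (suc h) (2 ^ h) ≡ 2 ^ suc h
minInternals-[1+h]-2^h h = trans (minInternals-[1+h] h (1≤2^n h) ≤-refl) (1+minInternals-2^h h)

minInternals-1 : ∀ h → minInternals h 1 ≡ suc h
minInternals-1 zero    = refl
minInternals-1 (suc h) = trans (minInternals-[1+h] h ≤-refl (1≤2^n h)) (cong suc (minInternals-1 h))

-- At most 2^h − 1 internal nodes lie above depth h, and exactly k at depth h.
record Feasible (h n k : ℕ) : Set where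
  constructor feasible
  field
    1≤k            : 1 ≤ k
    k≤2^h          : k ≤ 2 ^ h
    minInternals≤n : minInternals h k ≤ n
    n<2^h+k        : n < 2 ^ h + k

Feasible-0 : ∀ {n k} → Feasible 0 n k → n ≡ 1 × k ≡ 1
Feasible-0 {n} {k} (feasible 1≤k k≤1 k≤n n<1+k) = ≤-antisym n≤1 (≤-trans 1≤k k≤n) , k≡1
  where
  k≡1 : k ≡ 1
  k≡1 = ≤-antisym k≤1 1≤k
  n≤1 : n ≤ 1
  n≤1 = s≤s⁻¹ (subst (n <_) (cong suc k≡1) n<1+k)

feasible-step : ∀ {h n y x} → Feasible h n y → x ≤ 2 * y → 1 ≤ x → Feasible (suc h) (n + x) x
feasible-step {h} {n} {y} {x} (feasible _ y≤P μ≤n n<P+y) x≤2y 1≤x =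
  feasible 1≤x (≤-trans x≤2y (*-monoʳ-≤ 2 y≤P)) μ≤n+x (+-monoˡ-< x n<2P)
  where
  μ≤n+x : x + minInternals h ⌈ x /2⌉ ≤ n + x
  μ≤n+x = begin
    x + minInternals h ⌈ x /2⌉   ≤⟨ +-monoʳ-≤ x (minInternals-mono h (n≤2*m⇒⌈n/2⌉≤m x≤2y)) ⟩
    x + minInternals h y         ≤⟨ +-monoʳ-≤ x μ≤n ⟩
    x + n                        ≡⟨ +-comm x n ⟩
    n + x                        ∎
    where open ≤-Reasoning
  n<2P : n < 2 ^ suc h
  n<2P = begin-strict
    n                 <⟨ n<P+y ⟩
    2 ^ h + y         ≤⟨ +-monoʳ-≤ (2 ^ h) y≤P ⟩
    2 ^ h + 2 ^ h     ≡⟨ 2*n≡n+n (2 ^ h) ⟨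
    2 ^ suc h         ∎
    where open ≤-Reasoning

grow⇒Feasible : ∀ {h n m x} → Counts h n m → x ≤ m → 1 ≤ x → Feasible h (n + x) x
grow⇒Feasible {x = 1} start _ _ = feasible ≤-refl ≤-refl ≤-refl ≤-refl
grow⇒Feasible {x = 2+ _} start (s≤s ()) _
grow⇒Feasible (grow y y≤m c) x≤2y 1≤x =
  feasible-step (grow⇒Feasible c y≤m (≤-trans (⌈n/2⌉-mono 1≤x) (n≤2*m⇒⌈n/2⌉≤m x≤2y))) x≤2y 1≤x

Counts⇒Feasible : ∀ {h n m k} → Counts (suc h) n m → m ≡ 2 * k → 1 ≤ k → Feasible h n k
Counts⇒Feasible {k = k} (grow x x≤m c) m≡2k 1≤k with *-cancelˡ-≡ x k 2 m≡2k
... | refl = grow⇒Feasible c x≤m 1≤k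

feasible-widen : ∀ h {a n} → 1 ≤ a → a ≤ 2 ^ h → minInternals h a ≤ n → n < 2 ^ suc h →
                 ∃[ y ] (a ≤ y × Feasible h n y)
feasible-widen h {a} {n} 1≤a a≤P μ≤n n<2P with n <? 2 ^ h + a
... | yes n<P+a = a , ≤-refl , feasible 1≤a a≤P μ≤n n<P+a
-- n is too large for a: take y = n − 2^h + 1, the least y with n < 2^h + y.
... | no  n≮P+a = suc (n ∸ P) , a≤y , feasible (s≤s z≤n) y≤P μ≤n′ (subst (n <_) (sym P+y≡1+n) ≤-refl)
  where
  P : ℕ
  P = 2 ^ h
  P+a≤n : P + a ≤ n
  P+a≤n = ≮⇒≥ n≮P+a
  P≤n : P ≤ n
  P≤n = ≤-trans (m≤m+n P a) P+a≤n
  a≤y : a ≤ suc (n ∸ P)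
  a≤y = m≤n⇒m≤1+n (m+n≤o⇒m≤o∸n a (subst (_≤ n) (+-comm P a) P+a≤n))
  y≤P : suc (n ∸ P) ≤ P
  y≤P = +-cancelʳ-< P (n ∸ P) P (subst (_< P + P) (sym (m∸n+n≡m P≤n)) (subst (n <_) (2*n≡n+n P) n<2P))
  P+y≡1+n : P + suc (n ∸ P) ≡ suc n
  P+y≡1+n = trans (+-suc P (n ∸ P)) (cong suc (m+[n∸m]≡n P≤n))
  μ≤n′ : minInternals h (suc (n ∸ P)) ≤ n
  μ≤n′ = s≤s⁻¹ (subst (minInternals h (suc (n ∸ P)) <_) P+y≡1+n (minInternals<2^h+k h (s≤s z≤n) y≤P))

feasible-predecessor : ∀ h {n k} → Feasible (suc h) n k →
                       ∃[ y ] ∃[ n₀ ] (Feasible h n₀ y × k ≤ 2 * y × n ≡ n₀ + k)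
feasible-predecessor h {n} {k} (feasible 1≤k k≤2P k+μ≤n n<2P+k) =
  let y , ⌈k/2⌉≤y , f = feasible-widen h (⌈n/2⌉-mono 1≤k) (n≤2*m⇒⌈n/2⌉≤m k≤2P) μ≤n₀ n₀<2P
  in  y , n ∸ k , f , ⌈n/2⌉≤m⇒n≤2*m k ⌈k/2⌉≤y , sym n₀+k≡n
  where
  n₀+k≡n : n ∸ k + k ≡ n
  n₀+k≡n = m∸n+n≡m (≤-trans (m≤m+n k _) k+μ≤n)
  μ≤n₀ : minInternals h ⌈ k /2⌉ ≤ n ∸ k
  μ≤n₀ = m+n≤o⇒m≤o∸n _ (subst (_≤ n) (+-comm k _) k+μ≤n)
  n₀<2P : n ∸ k < 2 ^ suc h
  n₀<2P = +-cancelʳ-< k (n ∸ k) _ (subst (_< 2 ^ suc h + k) (sym n₀+k≡n) n<2P+k)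

Feasible⇒Counts : ∀ h {n k} → Feasible h n k → Counts (suc h) n (2 * k)
Feasible⇒Counts zero f with Feasible-0 f
... | refl , refl = grow 1 ≤-refl start
Feasible⇒Counts (suc h) f with feasible-predecessor h f
... | y , n₀ , f₀ , k≤2y , refl = grow _ k≤2y (Feasible⇒Counts h f₀)

TNonzero⇔Feasible : ∀ h {n k} → TNonzero n (2 * k) (suc h) ⇔ Feasible h n k
TNonzero⇔Feasible h {n} {k} = mk⇔
  (λ t → let 1≤2k , c = Equivalence.to TNonzero⇔Counts t in Counts⇒Feasible c refl (n≤2*m⇒⌈n/2⌉≤m 1≤2k))
  (λ f → Equivalence.from TNonzero⇔Counts (≤-trans (Feasible.1≤k f) (m≤m+n k _) , Feasible⇒Counts h f))

-- n is still feasible for k (below 2^h + k) but not yet for k + 1 (below minInternals h (1 + k)).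
frontierEnd : ℕ → ℕ → ℕ
frontierEnd h k = minInternals h (suc k) ⊓ (2 ^ h + k)

record Frontier (h n k : ℕ) : Set where
  constructor frontier
  field
    1≤k             : 1 ≤ k
    k≤2^h           : k ≤ 2 ^ h
    minInternals≤n  : minInternals h k ≤ n
    n<frontierEnd   : n < frontierEnd h k

frontierEnd-<2^h : ∀ h {k} → k < 2 ^ h → frontierEnd h k ≡ minInternals h (suc k)
frontierEnd-<2^h h {k} k<P = m≤n⇒m⊓n≡m
  (s≤s⁻¹ (subst (minInternals h (suc k) <_) (+-suc (2 ^ h) k) (minInternals<2^h+k h (s≤s z≤n) k<P)))

frontierEnd-2^h : ∀ h → frontierEnd h (2 ^ h) ≡ 2 ^ suc h
frontierEnd-2^h h = trans (m≥n⇒m⊓n≡n P+P≤μ) (sym (2*n≡n+n P))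
  where
  P : ℕ
  P = 2 ^ h
  P+P≤μ : P + P ≤ minInternals h (suc P)
  P+P≤μ = subst (_≤ minInternals h (suc P)) (trans (1+minInternals-2^h h) (2*n≡n+n P))
                (minInternals-<-[1+k] h P)

frontierEnd-[1+h] : ∀ h {k} → k < 2 ^ h → frontierEnd (suc h) k ≡ suc (frontierEnd h k)
frontierEnd-[1+h] h {k} k<P = begin
  frontierEnd (suc h) k            ≡⟨ frontierEnd-<2^h (suc h) (<-trans k<P (2^n<2^[1+n] h)) ⟩
  minInternals (suc h) (suc k)     ≡⟨ minInternals-[1+h] h (s≤s z≤n) k<P ⟩
  suc (minInternals h (suc k))     ≡⟨ cong suc (frontierEnd-<2^h h k<P) ⟨
  suc (frontierEnd h k)            ∎
  where open ≡-Reasoning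

frontierEnd-[1+h]-2^h : ∀ h → frontierEnd (suc h) (2 ^ h) ≡ 2 ^ suc h + suc h
frontierEnd-[1+h]-2^h h = begin
  frontierEnd (suc h) (2 ^ h)          ≡⟨ frontierEnd-<2^h (suc h) (2^n<2^[1+n] h) ⟩
  minInternals (suc h) (1 + 2 ^ h)     ≡⟨ minInternals-[1+h]-+2^h h ≤-refl (1≤2^n h) ⟩
  minInternals h 1 + 2 ^ suc h         ≡⟨ cong (_+ 2 ^ suc h) (minInternals-1 h) ⟩
  suc h + 2 ^ suc h                    ≡⟨ +-comm (suc h) _ ⟩
  2 ^ suc h + suc h                    ∎
  where open ≡-Reasoning

frontierEnd-[1+h]-+2^h : ∀ h {k} → k ≤ 2 ^ h →
                         frontierEnd (suc h) (k + 2 ^ h) ≡ frontierEnd h k + 2 ^ suc h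
frontierEnd-[1+h]-+2^h h {k} k≤P with m≤n⇒m<n∨m≡n k≤P
... | inj₁ k<P = begin
  frontierEnd (suc h) (k + P)           ≡⟨ frontierEnd-<2^h (suc h) k+P<Q ⟩
  minInternals (suc h) (suc k + P)      ≡⟨ minInternals-[1+h]-+2^h h (s≤s z≤n) k<P ⟩
  minInternals h (suc k) + Q            ≡⟨ cong (_+ Q) (frontierEnd-<2^h h k<P) ⟨
  frontierEnd h k + Q                   ∎
  where
  open ≡-Reasoning
  P Q : ℕ
  P = 2 ^ h
  Q = 2 ^ suc h
  k+P<Q : k + P < Q
  k+P<Q = subst (k + P <_) (sym (2*n≡n+n P)) (+-monoˡ-< P k<P)
... | inj₂ refl = begin
  frontierEnd (suc h) (P + P)           ≡⟨ cong (frontierEnd (suc h)) (2*n≡n+n P) ⟨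
  frontierEnd (suc h) Q                 ≡⟨ frontierEnd-2^h (suc h) ⟩
  2 * Q                                 ≡⟨ 2*n≡n+n Q ⟩
  Q + Q                                 ≡⟨ cong (_+ Q) (frontierEnd-2^h h) ⟨
  frontierEnd h P + Q                   ∎
  where
  open ≡-Reasoning
  P Q : ℕ
  P = 2 ^ h
  Q = 2 ^ suc h

Frontier⇒Feasible : ∀ {h n k} → Frontier h n k → Feasible h n k
Frontier⇒Feasible (frontier 1≤k k≤P μ≤n n<end) = feasible 1≤k k≤P μ≤n (<-≤-trans n<end (m⊓n≤n _ _))

Feasible×¬Feasible⇔Frontier : ∀ h {n k} → (Feasible h n k × ¬ Feasible h n (suc k)) ⇔ Frontier h n k
Feasible×¬Feasible⇔Frontier h {n} {k} = mk⇔ to from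
  where
  P : ℕ
  P = 2 ^ h
  to : Feasible h n k × ¬ Feasible h n (suc k) → Frontier h n k
  to (feasible 1≤k k≤P μ≤n n<P+k , infeasible) = frontier 1≤k k≤P μ≤n n<end
    where
    n<end : n < frontierEnd h k
    n<end with m≤n⇒m<n∨m≡n k≤P
    ... | inj₁ k<P rewrite frontierEnd-<2^h h k<P = ≰⇒> λ μ≤n′ →
          infeasible (feasible (s≤s z≤n) k<P μ≤n′ (<-≤-trans n<P+k (+-monoʳ-≤ P (n≤1+n k))))
    ... | inj₂ refl rewrite frontierEnd-2^h h = subst (n <_) (sym (2*n≡n+n P)) n<P+k
  from : Frontier h n k → Feasible h n k × ¬ Feasible h n (suc k)
  from fr = Frontier⇒Feasible fr , λ f →
    <⇒≱ (<-≤-trans (Frontier.n<frontierEnd fr) (m⊓n≤m _ _)) (Feasible.minInternals≤n f)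

Λ⇔Frontier : ∀ h {n k} → Λ (suc h) n k ⇔ Frontier h n k
Λ⇔Frontier h {n} {k} = Feasible×¬Feasible⇔Frontier h ⇔-∘ mk⇔ to from
  where
  tnonzero⇒feasible : ∀ {j} → TNonzero n (2 * j) (suc h) → Feasible h n j
  tnonzero⇒feasible = Equivalence.to (TNonzero⇔Feasible h)
  feasible⇒tnonzero : ∀ {j} → Feasible h n j → TNonzero n (2 * j) (suc h)
  feasible⇒tnonzero = Equivalence.from (TNonzero⇔Feasible h)
  to : Λ (suc h) n k → Feasible h n k × ¬ Feasible h n (suc k)
  to ((_ , _ , t) , ¬t′) =
    tnonzero⇒feasible t , ¬t′ ∘ feasible⇒tnonzero ∘ subst (Feasible h n) (+-comm 1 k)
  from : Feasible h n k × ¬ Feasible h n (suc k) → Λ (suc h) n k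
  from (f@(feasible 1≤k _ μ≤n _) , ¬f′) =
    (≤-trans 1≤k (≤-trans (k≤minInternals h k) μ≤n) , 1≤k , feasible⇒tnonzero f) ,
    ¬f′ ∘ subst (Feasible h n) (+-comm k 1) ∘ tnonzero⇒feasible

Frontier-below : ∀ h {n k} → k < 2 ^ h → Frontier (suc h) n k → σ 1 0 (Frontier h) n k
Frontier-below h {n} {k} k<P (frontier 1≤k _ μ≤n n<end)
  with shift-interval {minInternals h k} {frontierEnd h k} {1}
         (subst (_≤ n) (trans (minInternals-[1+h] h 1≤k (<⇒≤ k<P)) (+-comm 1 _)) μ≤n)
         (subst (n <_) (trans (frontierEnd-[1+h] h k<P) (+-comm 1 _)) n<end)
... | n₀ , μ≤n₀ , n₀<end , n≡ =
  n₀ , k , frontier 1≤k (<⇒≤ k<P) μ≤n₀ n₀<end , n≡ , sym (+-identityʳ k)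

Frontier-at : ∀ h {n} → Frontier (suc h) n (2 ^ h) → σ 1 0 (Frontier h) n (2 ^ h) ⊎ L (suc h) n (2 ^ h)
Frontier-at h {n} (frontier _ _ μ≤n n<end)
  with shift-interval {0} {suc h} {2 ^ suc h}
         (subst (_≤ n) (minInternals-[1+h]-2^h h) μ≤n)
         (subst (n <_) (trans (frontierEnd-[1+h]-2^h h) (+-comm _ (suc h))) n<end)
... | zero  , _ , _     , n≡ =
  inj₁ (minInternals h P , P , corner , trans n≡ (sym μ+1≡Q) , sym (+-identityʳ P))
  where
  P : ℕ
  P = 2 ^ h
  μ+1≡Q : minInternals h P + 1 ≡ 2 ^ suc h
  μ+1≡Q = trans (+-comm _ 1) (1+minInternals-2^h h)
  corner : Frontier h (minInternals h P) P
  corner = frontier (1≤2^n h) ≤-refl ≤-refl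
    (subst (minInternals h P <_) (sym (frontierEnd-2^h h)) (≤-reflexive (1+minInternals-2^h h)))
... | suc i , _ , i<1+h , n≡ = inj₂ (suc i , s≤s z≤n , s≤s⁻¹ i<1+h , trans n≡ (+-comm (suc i) _) , refl)

Frontier-above : ∀ h {n k} → 1 ≤ k → k ≤ 2 ^ h → Frontier (suc h) n (k + 2 ^ h) →
                 σ (2 ^ suc h) (2 ^ h) (Frontier h) n (k + 2 ^ h)
Frontier-above h {n} {k} 1≤k k≤P (frontier _ _ μ≤n n<end)
  with shift-interval {minInternals h k} {frontierEnd h k} {2 ^ suc h}
         (subst (_≤ n) (minInternals-[1+h]-+2^h h 1≤k k≤P) μ≤n)
         (subst (n <_) (frontierEnd-[1+h]-+2^h h k≤P) n<end)
... | n₀ , μ≤n₀ , n₀<end , n≡ = n₀ , k , frontier 1≤k k≤P μ≤n₀ n₀<end , n≡ , refl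

Frontier-shift₁ : ∀ h {n k} → Frontier h n k → Frontier (suc h) (suc n) k
Frontier-shift₁ h {n} {k} (frontier 1≤k k≤P μ≤n n<end) = frontier
  1≤k
  (≤-trans k≤P (<⇒≤ (2^n<2^[1+n] h)))
  (subst (_≤ suc n) (sym (minInternals-[1+h] h 1≤k k≤P)) (s≤s μ≤n))
  (<-≤-trans (s≤s n<end) end≤)
  where
  end≤ : suc (frontierEnd h k) ≤ frontierEnd (suc h) k
  end≤ with m≤n⇒m<n∨m≡n k≤P
  ... | inj₁ k<P  = ≤-reflexive (sym (frontierEnd-[1+h] h k<P))
  ... | inj₂ refl rewrite frontierEnd-2^h h | frontierEnd-[1+h]-2^h h =
    ≤-trans (≤-reflexive (+-comm 1 (2 ^ suc h))) (+-monoʳ-≤ (2 ^ suc h) (s≤s z≤n))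

Frontier-shift₂ : ∀ h {n k} → Frontier h n k → Frontier (suc h) (n + 2 ^ suc h) (k + 2 ^ h)
Frontier-shift₂ h {n} {k} (frontier 1≤k k≤P μ≤n n<end) = frontier
  (≤-trans 1≤k (m≤m+n k _))
  (subst (k + 2 ^ h ≤_) (sym (2*n≡n+n (2 ^ h))) (+-monoˡ-≤ (2 ^ h) k≤P))
  (subst (_≤ n + 2 ^ suc h) (sym (minInternals-[1+h]-+2^h h 1≤k k≤P)) (+-monoˡ-≤ (2 ^ suc h) μ≤n))
  (subst (n + 2 ^ suc h <_) (sym (frontierEnd-[1+h]-+2^h h k≤P)) (+-monoˡ-< (2 ^ suc h) n<end))

L⇒Frontier : ∀ h {n k} → L (suc h) n k → Frontier (suc h) n k
L⇒Frontier h (i , 1≤i , i≤h , refl , refl) = frontier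
  (1≤2^n h)
  (<⇒≤ (2^n<2^[1+n] h))
  (subst (_≤ 2 ^ suc h + i) (sym (minInternals-[1+h]-2^h h)) (m≤m+n _ i))
  (subst (2 ^ suc h + i <_) (sym (frontierEnd-[1+h]-2^h h)) (+-monoʳ-< (2 ^ suc h) (s≤s i≤h)))

Frontier-recursion : ∀ h {n k} → Frontier (suc h) n k ⇔
  (σ 1 0 (Frontier h) n k ⊎ L (suc h) n k ⊎ σ (2 ^ suc h) (2 ^ h) (Frontier h) n k)
Frontier-recursion h {n} {k} = mk⇔ to from
  where
  P : ℕ
  P = 2 ^ h
  Parts : Set
  Parts = σ 1 0 (Frontier h) n k ⊎ L (suc h) n k ⊎ σ (2 ^ suc h) P (Frontier h) n k
  to : Frontier (suc h) n k → Parts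
  to fr with <-cmp k P
  ... | tri< k<P _ _ = inj₁ (Frontier-below h k<P fr)
  ... | tri≈ _ refl _ = [ inj₁ , inj₂ ∘ inj₁ ]′ (Frontier-at h fr)
  ... | tri> _ _ P<k with shift-interval {1} {suc P} {P} P<k
                            (s≤s (subst (k ≤_) (2*n≡n+n P) (Frontier.k≤2^h fr)))
  ...   | k₀ , 1≤k₀ , k₀<1+P , refl = inj₂ (inj₂ (Frontier-above h 1≤k₀ (s≤s⁻¹ k₀<1+P) fr))
  from : Parts → Frontier (suc h) n k
  from (inj₁ (n₀ , k₀ , fr , refl , refl)) =
    subst₂ (Frontier (suc h)) (+-comm 1 n₀) (sym (+-identityʳ k₀)) (Frontier-shift₁ h fr)
  from (inj₂ (inj₁ row)) = L⇒Frontier h row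
  from (inj₂ (inj₂ (n₀ , k₀ , fr , refl , refl))) = Frontier-shift₂ h fr

σ-cong : ∀ i j {A B : ℕ → ℕ → Set} → (∀ n k → A n k ⇔ B n k) → ∀ {n k} → σ i j A n k ⇔ σ i j B n k
σ-cong i j A⇔B = mk⇔
  (λ (n′ , k′ , a , p , q) → n′ , k′ , Equivalence.to (A⇔B n′ k′) a , p , q)
  (λ (n′ , k′ , b , p , q) → n′ , k′ , Equivalence.from (A⇔B n′ k′) b , p , q)

Λ-recursion : ∀ h {n k} → Λ (suc (suc h)) n k ⇔
  (σ 1 0 (Λ (suc h)) n k ⊎ L (suc h) n k ⊎ σ (2 ^ suc h) (2 ^ h) (Λ (suc h)) n k)
Λ-recursion h =
  (σ-cong 1 0 Frontier⇔Λ ⊎-⇔ ⇔-id _ ⊎-⇔ σ-cong _ _ Frontier⇔Λ) ⇔-∘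
  (Frontier-recursion h ⇔-∘ Λ⇔Frontier (suc h))
  where
  Frontier⇔Λ : ∀ n k → Frontier h n k ⇔ Λ (suc h) n k
  Frontier⇔Λ _ _ = ⇔-sym (Λ⇔Frontier h)

HasCard-resp : ∀ {P Q c} → (∀ n k → P n k ⇔ Q n k) → HasCard P c → HasCard Q c
HasCard-resp P⇔Q (xs , unique , mem , len) = xs , unique , (λ n k → P⇔Q n k ⇔-∘ mem n k) , len

HasCard-singleton : ∀ a b → HasCard (λ n k → n ≡ a × k ≡ b) 1
HasCard-singleton a b = (a , b) ∷ [] , [] ∷ [] , (λ n k → mk⇔ to from) , refl
  where
  to : ∀ {n k} → (n , k) ∈ (a , b) ∷ [] → n ≡ a × k ≡ b
  to (here refl) = refl , refl
  from : ∀ {n k} → n ≡ a × k ≡ b → (n , k) ∈ (a , b) ∷ []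
  from (refl , refl) = here refl

HasCard-σ : ∀ i j {P c} → HasCard P c → HasCard (σ i j P) c
HasCard-σ i j {P} (xs , unique , mem , len) =
  map shift xs ,
  Unique.map⁺ shift-injective unique ,
  (λ n k → mk⇔ to from) ,
  trans (length-map shift xs) len
  where
  shift : ℕ × ℕ → ℕ × ℕ
  shift (n , k) = n + i , k + j
  shift-injective : ∀ {p q} → shift p ≡ shift q → p ≡ q
  shift-injective {n , k} {n′ , k′} e =
    cong₂ _,_ (+-cancelʳ-≡ i n n′ (cong proj₁ e)) (+-cancelʳ-≡ j k k′ (cong proj₂ e))
  to : ∀ {n k} → (n , k) ∈ map shift xs → σ i j P n k
  to p with ∈-map⁻ shift p
  ... | (n′ , k′) , p′ , e = n′ , k′ , Equivalence.to (mem n′ k′) p′ , cong proj₁ e , cong proj₂ e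
  from : ∀ {n k} → σ i j P n k → (n , k) ∈ map shift xs
  from (n′ , k′ , p , refl , refl) = ∈-map⁺ shift (Equivalence.from (mem n′ k′) p)

HasCard-⊎ : ∀ {P Q a b} → HasCard P a → HasCard Q b → (∀ {n k} → P n k → ¬ Q n k) →
            HasCard (λ n k → P n k ⊎ Q n k) (a + b)
HasCard-⊎ (xs , uxs , memP , lenP) (ys , uys , memQ , lenQ) P∩Q=∅ =
  xs ++ ys ,
  Unique.++⁺ uxs uys disjoint ,
  (λ n k → (memP n k ⊎-⇔ memQ n k) ⇔-∘ ++-∈⇔) ,
  trans (length-++ xs) (cong₂ _+_ lenP lenQ)
  where
  disjoint : ∀ {v} → ¬ (v ∈ xs × v ∈ ys)
  disjoint {n , k} (p , q) = P∩Q=∅ (Equivalence.to (memP n k) p) (Equivalence.to (memQ n k) q)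

HasCard-L : ∀ h → HasCard (L h) (h ∸ 1)
HasCard-L h =
  applyUpTo point (h ∸ 1) ,
  Unique.applyUpTo⁺₁ point (h ∸ 1) (λ i<j _ → <⇒≢ i<j ∘ point-injective) ,
  (λ n k → mk⇔ to from) ,
  length-applyUpTo point (h ∸ 1)
  where
  point : ℕ → ℕ × ℕ
  point i = 2 ^ h + suc i , 2 ^ (h ∸ 1)
  point-injective : ∀ {i j} → point i ≡ point j → i ≡ j
  point-injective e = suc-injective (+-cancelˡ-≡ (2 ^ h) _ _ (cong proj₁ e))
  to : ∀ {n k} → (n , k) ∈ applyUpTo point (h ∸ 1) → L h n k
  to p with ∈-applyUpTo⁻ point p
  ... | i , i< , e = suc i , s≤s z≤n , i< , cong proj₁ e , cong proj₂ e
  from : ∀ {n k} → L h n k → (n , k) ∈ applyUpTo point (h ∸ 1)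
  from (suc i , _ , i< , refl , refl) = ∈-applyUpTo⁺ point i<

Frontier-0 : ∀ {n k} → Frontier 0 n k ⇔ (n ≡ 1 × k ≡ 1)
Frontier-0 = mk⇔ (Feasible-0 ∘ Frontier⇒Feasible)
                 λ { (refl , refl) → frontier ≤-refl ≤-refl ≤-refl ≤-refl }

Frontier⇒n<2^[1+h] : ∀ {h n k} → Frontier h n k → n < 2 ^ suc h
Frontier⇒n<2^[1+h] {h} {n} {k} (frontier _ k≤P _ n<end) = begin-strict
  n                   <⟨ n<end ⟩
  frontierEnd h k     ≤⟨ m⊓n≤n _ _ ⟩
  2 ^ h + k           ≤⟨ +-monoʳ-≤ (2 ^ h) k≤P ⟩
  2 ^ h + 2 ^ h       ≡⟨ 2*n≡n+n (2 ^ h) ⟨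
  2 ^ suc h           ∎
  where open ≤-Reasoning

shift₁∩rest=∅ : ∀ h {n k} → σ 1 0 (Frontier h) n k →
                ¬ (L (suc h) n k ⊎ σ (2 ^ suc h) (2 ^ h) (Frontier h) n k)
shift₁∩rest=∅ h (n₀ , k₀ , fr , refl , refl) (inj₁ (i , 1≤i , _ , n₀+1≡Q+i , _)) =
  <⇒≱ (m<m+n (2 ^ suc h) 1≤i) (begin
    2 ^ suc h + i   ≡⟨ n₀+1≡Q+i ⟨
    n₀ + 1          ≡⟨ +-comm n₀ 1 ⟩
    suc n₀          ≤⟨ Frontier⇒n<2^[1+h] fr ⟩
    2 ^ suc h       ∎)
  where open ≤-Reasoning
shift₁∩rest=∅ h (n₀ , k₀ , fr , refl , refl) (inj₂ (_ , k₁ , fr₁ , _ , k₀+0≡k₁+P)) =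
  <⇒≱ (+-monoˡ-≤ (2 ^ h) (Frontier.1≤k fr₁)) (begin
    k₁ + 2 ^ h      ≡⟨ k₀+0≡k₁+P ⟨
    k₀ + 0          ≡⟨ +-identityʳ k₀ ⟩
    k₀              ≤⟨ Frontier.k≤2^h fr ⟩
    2 ^ h           ∎)
  where open ≤-Reasoning

L∩shift₂=∅ : ∀ h {n k} → L (suc h) n k → ¬ σ (2 ^ suc h) (2 ^ h) (Frontier h) n k
L∩shift₂=∅ h (_ , _ , _ , _ , refl) (_ , k₁ , fr₁ , _ , P≡k₁+P) =
  <⇒≢ (+-monoˡ-≤ (2 ^ h) (Frontier.1≤k fr₁)) P≡k₁+P

count-doubling : ∀ h →
  (2 ^ suc h ∸ suc h) + (h + (2 ^ suc h ∸ suc h)) ≡ 2 ^ suc (suc h) ∸ suc (suc h)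
count-doubling h = begin
  a + (h + a)                                    ≡⟨ m+n∸n≡m (a + (h + a)) (2 + h) ⟨
  (a + (h + a)) + (2 + h) ∸ (2 + h)              ≡⟨ cong (_∸ (2 + h)) (regroup a h) ⟩
  ((a + suc h) + (a + suc h)) ∸ (2 + h)          ≡⟨ cong (λ q → (q + q) ∸ (2 + h)) (m∸n+n≡m 1+h≤Q) ⟩
  (Q + Q) ∸ (2 + h)                              ≡⟨ cong (_∸ (2 + h)) (2*n≡n+n Q) ⟨
  2 * Q ∸ (2 + h)                                ∎
  where
  open ≡-Reasoning
  Q a : ℕ
  Q = 2 ^ suc h
  a = Q ∸ suc h
  1+h≤Q : suc h ≤ Q
  1+h≤Q = ≤-trans (1+n≤2^n h) (<⇒≤ (2^n<2^[1+n] h))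
  regroup : ∀ a h → (a + (h + a)) + (2 + h) ≡ (a + suc h) + (a + suc h)
  regroup = solve-∀

Frontier-card : ∀ h → HasCard (Frontier h) (2 ^ suc h ∸ suc h)
Frontier-card zero    = HasCard-resp (λ _ _ → ⇔-sym Frontier-0) (HasCard-singleton 1 1)
Frontier-card (suc h) = subst (HasCard (Frontier (suc h))) (count-doubling h)
  (HasCard-resp (λ _ _ → ⇔-sym (Frontier-recursion h))
    (HasCard-⊎ (HasCard-σ 1 0 (Frontier-card h))
      (HasCard-⊎ (HasCard-L (suc h)) (HasCard-σ (2 ^ suc h) (2 ^ h) (Frontier-card h)) (L∩shift₂=∅ h))
      (shift₁∩rest=∅ h)))

lemmaB6 : ∀ (h : ℕ) → 1 ≤ h →
    (∀ n k → Λ (suc h) n k ⇔ (σ 1 0 (Λ h) n k ⊎ L h n k ⊎ σ (2 ^ h) (2 ^ (h ∸ 1)) (Λ h) n k))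
    × HasCard (Λ h) (2 ^ h ∸ h)
lemmaB6 zero    ()
lemmaB6 (suc h) _ =
  (λ _ _ → Λ-recursion h) ,
  HasCard-resp (λ _ _ → ⇔-sym (Λ⇔Frontier h)) (Frontier-card h)
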